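{- Let $G=(V,E)$ be a finite undirected graph with $n=|V|\ge 1$. Let $\mathcal{B}$ be the chain $\emptyset=B_0\subsetneq\cdots\subsetneq B_k=V$ of all locally dense subsets of $V$, and let $\mathcal{C}$ be the chain $\emptyset=C_0\subsetneq C_1\subsetneq\cdots\subsetneq C_l=V$ of all distinct $k$-cores of $G$ ($k=0,1,2,\dots$). Then for every $1\le i\le n$, $$p(i;\mathcal{C})\ge p(i;\mathcal{B})/2.$$
   Context: For $X\subseteq V$, $E(X)=\{(x,y)\in E: x,y\in X\}$. For disjoint $X,Y$, $E(X,Y)$ is the set of edges with one endpoint in $X$ and one in $Y$, $E_m(X,Y)=E(X)\cup E(X,Y)$, and for nonempty $X$ disjoint from $Y$, $d(X,Y)=|E_m(X,Y)|/|X|$; in general $d(X,Y)=d(X\setminus Y,Y)$. A set $W\subseteq V$ is locally dense if there do not exist a nonempty $X\subseteq W$ and a nonempty $Y\subseteq V$ with $Y\cap W=\emptyset$ such that $d(X,W\setminus X)\le d(Y,W)$; the locally dense sets form a chain from $\emptyset$ to $V$. For an integer $k\ge 0$, the $k$-core of $G$ is the maximal set $X\subseteq V$ such that every vertex of the subgraph induced by $X$ has degree at least $k$ in that subgraph (possibly empty); the $k$-cores form a nested chain containing $V$ (the $0$-core) and $\emptyset$. Profile: for a nested chain $\mathcal{A}=(\emptyset=A_0\subsetneq A_1\subsetneq\cdots\subsetneq A_\ell=V)$ and integer $1\le i\le n$, let $j=\min\{x: |A_x|\ge i\}$ and define $p(i;\mathcal{A})=d(A_j,A_{j-1})$. -}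

module Defs where

open import Data.Bool using (Bool; true; false; _∧_; _∨_; not; if_then_else_)
open import Data.Nat using (ℕ; zero; suc; _+_; _<ᵇ_; _≤?_)
open import Data.Fin using (Fin; zero; suc; toℕ; fromℕ; inject₁)
open import Data.Fin.Subset using (Subset; ⊥; ⊤; _∈_; _⊆_; _⊂_; _∩_; _─_; ∣_∣; Nonempty; Empty)
open import Data.Vec using (lookup; tabulate)
open import Data.Integer using (+_)
open import Data.Rational using (ℚ; 0ℚ; _/_) renaming (_≤_ to _≤ℚ_)
open import Data.Product using (Σ; ∃; _×_)
open import Relation.Nullary using (¬_; yes; no)
open import Relation.Binary.PropositionalEquality using (_≡_)

record Graph (n : ℕ) : Set where
  field
    adj    : Fin n → Fin n → Bool
    sym    : ∀ x y → adj x y ≡ adj y x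
    irrefl : ∀ x → adj x x ≡ false
open Graph public

sumFin : ∀ n → (Fin n → ℕ) → ℕ
sumFin zero    f = 0
sumFin (suc n) f = f zero + sumFin n (λ x → f (suc x))

mem : ∀ {n} → Subset n → Fin n → Bool
mem X x = lookup X x

b2n : Bool → ℕ
b2n true  = 1
b2n false = 0

-- |E_m(X \ Y, Y)| : the number of edges {x,y} (counted once, via toℕ x < toℕ y)
-- with both endpoints in (X \ Y) ∪ Y and at least one endpoint in X \ Y.
emCount : ∀ {n} → Graph n → Subset n → Subset n → ℕ
emCount {n} G X Y =
  sumFin n λ x → sumFin n λ y →
    b2n ((toℕ x <ᵇ toℕ y) ∧ adj G x y ∧
         ((mem X' x ∧ (mem X' y ∨ mem Y y)) ∨ (mem X' y ∧ (mem X' x ∨ mem Y x))))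
  where X' = X ─ Y

-- e / s as a rational (s = 0 never occurs in the uses below; value 0 then)
frac : ℕ → ℕ → ℚ
frac e zero    = 0ℚ
frac e (suc s) = (+ e) / suc s

d : ∀ {n} → Graph n → Subset n → Subset n → ℚ
d G X Y = frac (emCount G X Y) ∣ X ─ Y ∣

LocallyDense : ∀ {n} → Graph n → Subset n → Set
LocallyDense {n} G W =
  ¬ (Σ (Subset n) λ X → Σ (Subset n) λ Y →
       Nonempty X × X ⊆ W × Nonempty Y × Empty (Y ∩ W) ×
       (d G X (W ─ X) ≤ℚ d G Y W))

degIn : ∀ {n} → Graph n → Subset n → Fin n → ℕ
degIn {n} G X v = sumFin n λ w → b2n (mem X w ∧ adj G v w)

MinDeg : ∀ {n} → Graph n → ℕ → Subset n → Set
MinDeg G k X = ∀ v → v ∈ X → k Data.Nat.≤ degIn G X v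

IsCore : ∀ {n} → Graph n → ℕ → Subset n → Set
IsCore {n} G k X = MinDeg G k X × (∀ (Y : Subset n) → MinDeg G k Y → Y ⊆ X)

IsChain : ∀ {n ℓ} → (Fin (suc ℓ) → Subset n) → Set
IsChain {n} {ℓ} A =
  (A zero ≡ ⊥) × (A (fromℕ ℓ) ≡ ⊤) × (∀ (j : Fin ℓ) → A (inject₁ j) ⊂ A (suc j))

-- Profile p(i; A) = d(A_j, A_{j-1}) with j = min { x : |A_x| ≥ i }.
-- (Search over x = 1, 2, ...; the fall-through value 0 is never reached
-- for a chain ending in V and 1 ≤ i ≤ n.)
profile : ∀ {n} → Graph n → ∀ ℓ → (Fin (suc ℓ) → Subset n) → ℕ → ℚ
profile G zero    A i = 0ℚ
profile G (suc ℓ) A i with i ≤? ∣ A (suc zero) ∣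
... | yes _ = d G (A (suc zero)) (A zero)
... | no  _ = profile G ℓ (λ x → A (suc x)) i

module Submission where

-- Let A ⊊ S be consecutive locally dense sets with i ≤ ∣S∣, and δ = d(S, A).  Among the
-- sets A ⊊ W ⊆ S, one of maximal density d(W, A), ties broken towards larger sets, is
-- locally dense: extending it adds edges at a lower rate (split the new vertices along S
-- and use the maximality and the local density of S), removing a part loses them at a
-- higher rate (split the part along A and use the maximality and the local density of A).
-- Hence it is S, so S maximises d(·, A).  Comparing S with S - v, or using the local
-- density of A when v ∈ A, gives deg_S(v) ≥ δ for all v ∈ S, so S lies in the ⌈δ⌉-core.
-- The core layer realising p(i; 𝒞) then has minimum degree at least ⌈δ⌉, and counting
-- its new edges through degrees, each at most twice, gives density at least ⌈δ⌉ / 2.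

module Lemmas where

  open import Defs hiding (sym)
  open import Data.Nat.Properties
  open import Algebra.Properties.Semiring.Sum +-*-semiring
    using (sum; ∑-distrib-+; ∑-comm; sum-cong-≗; *-distribˡ-sum)
  open import Algebra.Properties.CommutativeSemigroup +-commutativeSemigroup
    using () renaming (interchange to +-interchange)
  open import Algebra.Properties.CommutativeSemigroup *-commutativeSemigroup
    using () renaming (xy∙z≈xz∙y to *-right-comm)
  open import Data.Bool using (Bool; true; false; _∧_; _∨_; not; T; f≤t; b≤b)
    renaming (_≤_ to _≤ᴮ_)
  open import Data.Bool.Properties using (∧-zeroʳ; ∧-identityʳ; ∨-identityʳ; ∧-comm; T-≡)
    renaming (_≤?_ to _≤ᴮ?_)
  open import Data.Empty using (⊥-elim)
  open import Data.Fin using (Fin; zero; suc; toℕ; fromℕ; inject₁)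
  open import Data.Fin.Properties using (toℕ-injective; all?)
  open import Data.Fin.Subset
    using (Subset; ⋃; ⁅_⁆; _∈_; _∉_; _⊆_; _⊂_; _∪_; _∩_; _─_; _-_; ∣_∣; Empty)
    renaming (⊥ to ∅)
  open import Data.Fin.Subset.Properties
    using ( _∈?_; _⊆?_; _⊂?_; nonempty?; Empty-unique; ⊆-refl; ⊆-trans; ⊆-antisym; ⊂-⊆-trans
          ; ⊥⊆; ∉⊥; ∣⊥∣≡0; ∣⊤∣≡n; ∣⁅x⁆∣≡1; x∈⁅y⁆⇒x≡y; p⊆q⇒∣p∣≤∣q∣; p⊂q⇒∣p∣<∣q∣
          ; x∈p∩q⁺; x∈p∩q⁻; p∩q⊆p; p∩q⊆q; x∈p∪q⁻; p⊆p∪q; q⊆p∪q; ∪-comm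
          ; p─q⊆p; p─q─q≡p─q; x∈p∧x∉q⇒x∈p─q; x∈p∧x≢y⇒x∈p-y; x∈p⇒p-x⊂p )
  open import Data.Nat
    using (ℕ; zero; suc; _+_; _*_; _≤_; _<_; _<ᵇ_; _≤?_; _≟_; z≤n; s≤s; z<s)
  import Data.Integer as ℤ
  import Data.Integer.Properties as ℤP
  open import Data.Rational using (ℚ; ½; toℚᵘ) renaming (_≤_ to _≤ℚ_; _<_ to _<ℚ_; _*_ to _*ℚ_)
  import Data.Rational.Properties as ℚP
  open ℚP using (toℚᵘ-injective; toℚᵘ-homo-*; toℚᵘ-fromℚᵘ; toℚᵘ-mono-≤; toℚᵘ-cancel-≤)
  open import Data.Rational.Unnormalised as ℚᵘ using (mkℚᵘ)
  import Data.Rational.Unnormalised.Properties as ℚᵘP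
  import Data.List as List
  open import Data.List using (List; []; _∷_; _++_; filter)
  import Data.List.Extrema as Extrema
  open import Data.List.Membership.Propositional using () renaming (_∈_ to _∈ˡ_)
  open import Data.List.Membership.Propositional.Properties using (∈-map⁺; ∈-++⁺ˡ; ∈-++⁺ʳ; ∈-filter⁺)
  open import Data.List.Relation.Unary.All as All using (All; []; _∷_)
  open import Data.List.Relation.Unary.All.Properties using (all-filter)
  open import Data.List.Relation.Unary.Any using (here; there)
  open import Data.Product using (∃; _×_; _,_; proj₁; proj₂)
  open import Data.Product.Relation.Binary.Lex.NonStrict using (×-totalOrder)
  open import Data.Sum using (_⊎_; inj₁; inj₂; [_,_])
  open import Data.Vec using ([]; _∷_)
  open import Data.Vec.Properties
    using ([]=⇒lookup; lookup⇒[]=; lookup-zipWith; tabulate∘lookup; tabulate-cong)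
  open import Function using (_∘_; _⇔_; mk⇔; Equivalence; case_of_)
  open import Relation.Binary.Bundles using (TotalOrder)
  open import Relation.Binary.Definitions using (tri<; tri≈; tri>)
  open import Relation.Binary.PropositionalEquality
    using (_≡_; refl; sym; trans; cong; cong₂; subst; subst₂; module ≡-Reasoning)
  open import Relation.Nullary using (¬_; Dec; yes; no)
  open import Relation.Nullary.Decidable using (True; toWitness; map′; _×-dec_; _→-dec_)

  private
    variable
      n : ℕ
      p q X : Subset n

  ∀-Bool? : {P : Bool → Set} → (∀ b → Dec (P b)) → Dec (∀ b → P b)
  ∀-Bool? P? with P? false | P? true
  ... | yes f | yes t = yes λ { false → f ; true → t }
  ... | no ¬f | _     = no λ ∀P → ¬f (∀P false)
  ... | _     | no ¬t = no λ ∀P → ¬t (∀P true)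

  -- The implicit argument is found by evaluating all sixteen cases.
  by-truth-table : {P : Bool → Bool → Bool → Bool → Set} →
    (P? : ∀ a b c d → Dec (P a b c d)) →
    {_ : True (∀-Bool? λ a → ∀-Bool? λ b → ∀-Bool? λ c → ∀-Bool? (P? a b c))} →
    ∀ a b c d → P a b c d
  by-truth-table P? {holds} = toWitness holds

  sumFin≡sum : ∀ n (f : Fin n → ℕ) → sumFin n f ≡ sum f
  sumFin≡sum zero    f = refl
  sumFin≡sum (suc n) f = cong (f zero +_) (sumFin≡sum n (f ∘ suc))

  sum-mono-≤ : {f g : Fin n → ℕ} → (∀ i → f i ≤ g i) → sum f ≤ sum g
  sum-mono-≤ {zero}  _   = z≤n
  sum-mono-≤ {suc n} f≤g = +-mono-≤ (f≤g zero) (sum-mono-≤ (f≤g ∘ suc))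

  least-witness : ∀ {P : ℕ → Set} → (∀ t → Dec (P t)) → ∀ m {u} → u ≤ m → P u →
                  ∃ λ t → P t × (∀ {v} → P v → t ≤ v)
  least-witness P? zero    z≤n P0 = 0 , P0 , λ _ → z≤n
  least-witness P? (suc m) {u} u≤1+m Pu with anyUpTo? P? (suc m)
  ... | yes (v , s≤s v≤m , Pv) = least-witness P? m v≤m Pv
  ... | no  ∄v = u , Pu , λ {v} Pv → ≤-trans u≤1+m (≮⇒≥ λ v<1+m → ∄v (v , v<1+m , Pv))

  <ᵇ≡true : ∀ {i j} → i < j → (i <ᵇ j) ≡ true
  <ᵇ≡true i<j = Equivalence.to T-≡ (<⇒<ᵇ i<j)

  <ᵇ≡false : ∀ {i j} → ¬ i < j → (i <ᵇ j) ≡ false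
  <ᵇ≡false {i} {j} i≮j with i <ᵇ j in i<ᵇj
  ... | false = refl
  ... | true  = ⊥-elim (i≮j (<ᵇ⇒< i j (Equivalence.from T-≡ i<ᵇj)))

  mem-∪ : ∀ (p q : Subset n) x → mem (p ∪ q) x ≡ mem p x ∨ mem q x
  mem-∪ p q x = lookup-zipWith _∨_ x p q

  mem-∩ : ∀ (p q : Subset n) x → mem (p ∩ q) x ≡ mem p x ∧ mem q x
  mem-∩ p q x = lookup-zipWith _∧_ x p q

  mem-─ : ∀ (p q : Subset n) x → mem (p ─ q) x ≡ mem p x ∧ not (mem q x)
  mem-─ (a ∷ p) (true  ∷ q) zero    = sym (∧-zeroʳ a)
  mem-─ (a ∷ p) (false ∷ q) zero    = sym (∧-identityʳ a)
  mem-─ (a ∷ p) (b     ∷ q) (suc x) = mem-─ p q x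

  ∈⇒mem : ∀ {x} → x ∈ p → mem p x ≡ true
  ∈⇒mem = []=⇒lookup

  mem⇒∈ : ∀ {x} → mem p x ≡ true → x ∈ p
  mem⇒∈ {p = p} {x} = lookup⇒[]= x p

  ⊆⇒mem-≤ : p ⊆ q → ∀ x → mem p x ≤ᴮ mem q x
  ⊆⇒mem-≤ {p = p} {q} p⊆q x with mem p x in px | mem q x in qx
  ... | false | false = b≤b
  ... | false | true  = f≤t
  ... | true  | true  = b≤b
  ... | true  | false with trans (sym qx) (∈⇒mem (p⊆q (mem⇒∈ px)))
  ...   | ()

  mem-ext : (∀ x → mem p x ≡ mem q x) → p ≡ q
  mem-ext {p = p} {q} p≗q =
    trans (sym (tabulate∘lookup p)) (trans (tabulate-cong p≗q) (tabulate∘lookup q))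

  x∈p─q⇒x∉q : ∀ {x} → x ∈ p ─ q → x ∉ q
  x∈p─q⇒x∉q {p = p} {q} {x} x∈p─q x∈q = subst T (begin
    true                      ≡⟨ ∈⇒mem x∈p─q ⟨
    mem (p ─ q) x             ≡⟨ mem-─ p q x ⟩
    mem p x ∧ not (mem q x)   ≡⟨ cong (λ b → mem p x ∧ not b) (∈⇒mem x∈q) ⟩
    mem p x ∧ false           ≡⟨ ∧-zeroʳ (mem p x) ⟩
    false                     ∎) _
    where open ≡-Reasoning

  x∈p⇒⁅x⁆⊆p : ∀ {x} → x ∈ p → ⁅ x ⁆ ⊆ p
  x∈p⇒⁅x⁆⊆p {p = p} {x} x∈p y∈⁅x⁆ = subst (_∈ p) (sym (x∈⁅y⁆⇒x≡y x y∈⁅x⁆)) x∈p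

  ⊆⇒≡⊎⊂ : p ⊆ q → p ≡ q ⊎ p ⊂ q
  ⊆⇒≡⊎⊂ {p = p} {q} p⊆q with nonempty? (q ─ p)
  ... | yes (x , x∈q─p) = inj₂ (p⊆q , x , p─q⊆p q p x∈q─p , x∈p─q⇒x∉q x∈q─p)
  ... | no  q─p-empty   = inj₁ (⊆-antisym p⊆q q⊆p)
    where
    q⊆p : q ⊆ p
    q⊆p {x} x∈q with x ∈? p
    ... | yes x∈p = x∈p
    ... | no  x∉p = ⊥-elim (q─p-empty (x , x∈p∧x∉q⇒x∈p─q x∈q x∉p))

  p─[p─q]≡q : q ⊆ p → p ─ (p ─ q) ≡ q
  p─[p─q]≡q {q = q} {p} q⊆p = mem-ext λ x → begin
    mem (p ─ (p ─ q)) x                       ≡⟨ mem-─ p (p ─ q) x ⟩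
    mem p x ∧ not (mem (p ─ q) x)             ≡⟨ cong (λ b → mem p x ∧ not b) (mem-─ p q x) ⟩
    mem p x ∧ not (mem p x ∧ not (mem q x))   ≡⟨ pointwise (⊆⇒mem-≤ q⊆p x) ⟩
    mem q x                                   ∎
    where
    open ≡-Reasoning
    pointwise : ∀ {a b} → b ≤ᴮ a → a ∧ not (a ∧ not b) ≡ b
    pointwise f≤t           = refl
    pointwise (b≤b {false}) = refl
    pointwise (b≤b {true})  = refl

  [p∪q]─q≡p─q : ∀ (p q : Subset n) → (p ∪ q) ─ q ≡ p ─ q
  [p∪q]─q≡p─q p q = mem-ext λ x → begin
    mem ((p ∪ q) ─ q) x                   ≡⟨ mem-─ (p ∪ q) q x ⟩
    mem (p ∪ q) x ∧ not (mem q x)         ≡⟨ cong (λ b → b ∧ not (mem q x)) (mem-∪ p q x) ⟩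
    (mem p x ∨ mem q x) ∧ not (mem q x)   ≡⟨ pointwise (mem p x) (mem q x) ⟩
    mem p x ∧ not (mem q x)               ≡⟨ mem-─ p q x ⟨
    mem (p ─ q) x                         ∎
    where
    open ≡-Reasoning
    pointwise : ∀ a b → (a ∨ b) ∧ not b ≡ a ∧ not b
    pointwise a true  = trans (∧-zeroʳ (a ∨ true)) (sym (∧-zeroʳ a))
    pointwise a false = cong (_∧ true) (∨-identityʳ a)

  p─[p∩q]≡p─q : ∀ (p q : Subset n) → p ─ (p ∩ q) ≡ p ─ q
  p─[p∩q]≡p─q p q = mem-ext λ x → begin
    mem (p ─ (p ∩ q)) x                   ≡⟨ mem-─ p (p ∩ q) x ⟩
    mem p x ∧ not (mem (p ∩ q) x)         ≡⟨ cong (λ b → mem p x ∧ not b) (mem-∩ p q x) ⟩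
    mem p x ∧ not (mem p x ∧ mem q x)     ≡⟨ pointwise (mem p x) (mem q x) ⟩
    mem p x ∧ not (mem q x)               ≡⟨ mem-─ p q x ⟨
    mem (p ─ q) x                         ∎
    where
    open ≡-Reasoning
    pointwise : ∀ a b → a ∧ not (a ∧ b) ≡ a ∧ not b
    pointwise true  b = refl
    pointwise false b = refl

  p⊆q⇒q∪p≡q : p ⊆ q → q ∪ p ≡ q
  p⊆q⇒q∪p≡q {p = p} {q} p⊆q = mem-ext λ x → trans (mem-∪ q p x) (pointwise (⊆⇒mem-≤ p⊆q x))
    where
    pointwise : ∀ {a b} → a ≤ᴮ b → b ∨ a ≡ b
    pointwise f≤t           = refl
    pointwise (b≤b {false}) = refl
    pointwise (b≤b {true})  = refl

  ∈⇒⊆⋃ : ∀ {Xs} → X ∈ˡ Xs → X ⊆ ⋃ Xs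
  ∈⇒⊆⋃ (here refl)                = p⊆p∪q _
  ∈⇒⊆⋃ {Xs = Y ∷ Ys} (there X∈Ys) = ⊆-trans (∈⇒⊆⋃ X∈Ys) (q⊆p∪q Y (⋃ Ys))

  allSubsets : ∀ n → List (Subset n)
  allSubsets zero    = [] ∷ []
  allSubsets (suc n) = List.map (true ∷_) (allSubsets n) ++ List.map (false ∷_) (allSubsets n)

  ∈-allSubsets : ∀ (p : Subset n) → p ∈ˡ allSubsets n
  ∈-allSubsets []                  = here refl
  ∈-allSubsets {suc n} (true  ∷ p) = ∈-++⁺ˡ (∈-map⁺ (true ∷_) (∈-allSubsets p))
  ∈-allSubsets {suc n} (false ∷ p) =
    ∈-++⁺ʳ (List.map (true ∷_) (allSubsets n)) (∈-map⁺ (false ∷_) (∈-allSubsets p))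

  ∣p∣≡∑ : ∀ (p : Subset n) → ∣ p ∣ ≡ sum (λ x → b2n (mem p x))
  ∣p∣≡∑ []          = refl
  ∣p∣≡∑ (true  ∷ p) = cong suc (∣p∣≡∑ p)
  ∣p∣≡∑ (false ∷ p) = ∣p∣≡∑ p

  ∣p─p∣≡0 : ∀ (p : Subset n) → ∣ p ─ p ∣ ≡ 0
  ∣p─p∣≡0 {n} p = trans (cong ∣_∣ (Empty-unique p─p-empty)) (∣⊥∣≡0 n)
    where
    p─p-empty : Empty (p ─ p)
    p─p-empty (x , x∈p─p) = x∈p─q⇒x∉q x∈p─p (p─q⊆p p p x∈p─p)

  p⊂q⇒∣q─p∣>0 : ∀ {n} {p q : Subset n} → p ⊂ q → 0 < ∣ q ─ p ∣
  p⊂q⇒∣q─p∣>0 {n} {p} {q} (_ , x , x∈q , x∉p) =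
    subst (_< ∣ q ─ p ∣) (∣⊥∣≡0 n) (p⊂q⇒∣p∣<∣q∣ (⊥⊆ , x , x∈p∧x∉q⇒x∈p─q x∈q x∉p , ∉⊥))

  ∣r─p∣≡∣r─q∣+∣q─p∣ : ∀ {n} {p q r : Subset n} → p ⊆ q → q ⊆ r → ∣ r ─ p ∣ ≡ ∣ r ─ q ∣ + ∣ q ─ p ∣
  ∣r─p∣≡∣r─q∣+∣q─p∣ {n} {p} {q} {r} p⊆q q⊆r = begin
    ∣ r ─ p ∣                                               ≡⟨ ∣p∣≡∑ (r ─ p) ⟩
    sum (λ x → b2n (mem (r ─ p) x))                         ≡⟨ sum-cong-≗ pointwise ⟩
    sum (λ x → b2n (mem (r ─ q) x) + b2n (mem (q ─ p) x))   ≡⟨ ∑-distrib-+ {n} _ _ ⟩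
    sum (λ x → b2n (mem (r ─ q) x)) + sum (λ x → b2n (mem (q ─ p) x))
      ≡⟨ cong₂ _+_ (∣p∣≡∑ (r ─ q)) (∣p∣≡∑ (q ─ p)) ⟨
    ∣ r ─ q ∣ + ∣ q ─ p ∣                                   ∎
    where
    open ≡-Reasoning
    split : ∀ {a b c} → a ≤ᴮ b → b ≤ᴮ c → b2n (c ∧ not a) ≡ b2n (c ∧ not b) + b2n (b ∧ not a)
    split (b≤b {false}) (b≤b {false}) = refl
    split (b≤b {false}) f≤t           = refl
    split f≤t           (b≤b {true})  = refl
    split (b≤b {true})  (b≤b {true})  = refl
    pointwise : ∀ x → b2n (mem (r ─ p) x) ≡ b2n (mem (r ─ q) x) + b2n (mem (q ─ p) x)
    pointwise x rewrite mem-─ r p x | mem-─ r q x | mem-─ q p x = split (⊆⇒mem-≤ p⊆q x) (⊆⇒mem-≤ q⊆r x)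

  -- a / b is kept as the pair (a , b) and compared by cross-multiplication, so that
  -- 0ᶠ = 0 / 0 can stand for the density of an empty difference.
  Frac : Set
  Frac = ℕ × ℕ

  0ᶠ : Frac
  0ᶠ = 0 , 0

  infix  4 _≤ᶠ_ _<ᶠ_ _<ᶠ⁰_
  infixl 6 _⊕_

  data _≤ᶠ_ : Frac → Frac → Set where
    *≤* : ∀ {a b c d} → a * d ≤ c * b → (a , b) ≤ᶠ (c , d)

  data _<ᶠ_ : Frac → Frac → Set where
    *<* : ∀ {a b c d} → a * d < c * b → (a , b) <ᶠ (c , d)

  _⊕_ : Frac → Frac → Frac
  (a , b) ⊕ (c , d) = a + c , b + d

  _<ᶠ⁰_ : Frac → Frac → Set
  x <ᶠ⁰ z = x ≡ 0ᶠ ⊎ x <ᶠ z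

  private
    variable
      x y z : Frac

  _≤ᶠ?_ : ∀ x y → Dec (x ≤ᶠ y)
  (a , b) ≤ᶠ? (c , d) = map′ *≤* (λ { (*≤* a*d≤c*b) → a*d≤c*b }) (a * d ≤? c * b)

  <ᶠ⇒≤ᶠ : x <ᶠ y → x ≤ᶠ y
  <ᶠ⇒≤ᶠ (*<* x<y) = *≤* (<⇒≤ x<y)

  <ᶠ-irrefl : ¬ x <ᶠ x
  <ᶠ-irrefl (*<* x<x) = <-irrefl refl x<x

  0ᶠ≤ᶠ : 0ᶠ ≤ᶠ z
  0ᶠ≤ᶠ = *≤* z≤n

  ≤ᶠ0ᶠ : z ≤ᶠ 0ᶠ
  ≤ᶠ0ᶠ {e , _} = *≤* (≤-reflexive (*-zeroʳ e))

  ≤ᶠ-mono-num : ∀ {a a′ b} → z ≤ᶠ (a , b) → a ≤ a′ → z ≤ᶠ (a′ , b)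
  ≤ᶠ-mono-num {_ , f} (*≤* z≤x) a≤a′ = *≤* (≤-trans z≤x (*-monoˡ-≤ f a≤a′))

  <ᶠ⁰-anti-num : ∀ {a a′ b} → a ≤ a′ → (a′ , b) <ᶠ⁰ z → (a , b) <ᶠ⁰ z
  <ᶠ⁰-anti-num a≤0  (inj₁ refl)      = inj₁ (cong (_, 0) (n≤0⇒n≡0 a≤0))
  <ᶠ⁰-anti-num a≤a′ (inj₂ (*<* x<z)) = inj₂ (*<* (≤-<-trans (*-monoˡ-≤ _ a≤a′) x<z))

  <ᶠ-≤ᶠ-trans : 0 < proj₂ z → x <ᶠ y → y ≤ᶠ z → x <ᶠ z
  <ᶠ-≤ᶠ-trans {e , f@(suc _)} {a , b} {c , d} _ (*<* x<y) (*≤* y≤z) =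
    *<* (*-cancelʳ-< d (a * f) (e * b) (begin-strict
      a * f * d   ≡⟨ *-right-comm a f d ⟩
      a * d * f   <⟨ *-monoˡ-< f x<y ⟩
      c * b * f   ≡⟨ *-right-comm c b f ⟩
      c * f * b   ≤⟨ *-monoˡ-≤ b y≤z ⟩
      e * d * b   ≡⟨ *-right-comm e d b ⟩
      e * b * d   ∎))
    where open ≤-Reasoning

  ≤ᶠ-mediant : z ≤ᶠ x → z ≤ᶠ y → z ≤ᶠ x ⊕ y
  ≤ᶠ-mediant {e , f} {a , b} {c , d} (*≤* z≤x) (*≤* z≤y) = *≤* (begin
    e * (b + d)     ≡⟨ *-distribˡ-+ e b d ⟩
    e * b + e * d   ≤⟨ +-mono-≤ z≤x z≤y ⟩
    a * f + c * f   ≡⟨ *-distribʳ-+ f a c ⟨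
    (a + c) * f     ∎)
    where open ≤-Reasoning

  mediant-<ᶠ : 0 < proj₂ (x ⊕ y) → x <ᶠ⁰ z → y <ᶠ⁰ z → x ⊕ y <ᶠ z
  mediant-<ᶠ ()  (inj₁ refl) (inj₁ refl)
  mediant-<ᶠ _   (inj₁ refl) (inj₂ y<z)  = y<z
  mediant-<ᶠ {a , b} {z = z} _ (inj₂ x<z) (inj₁ refl) =
    subst₂ (λ a′ b′ → (a′ , b′) <ᶠ z) (sym (+-identityʳ a)) (sym (+-identityʳ b)) x<z
  mediant-<ᶠ {a , b} {c , d} {e , f} _ (inj₂ (*<* x<z)) (inj₂ (*<* y<z)) = *<* (begin-strict
    (a + c) * f     ≡⟨ *-distribʳ-+ f a c ⟩
    a * f + c * f   <⟨ +-mono-<-≤ x<z (<⇒≤ y<z) ⟩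
    e * b + e * d   ≡⟨ *-distribˡ-+ e b d ⟨
    e * (b + d)     ∎)
    where open ≤-Reasoning

  ⊕<ᶠ⇒<ᶠ : ∀ x y → y ⊕ x <ᶠ x → y <ᶠ x
  ⊕<ᶠ⇒<ᶠ (a , b) (c , d) (*<* y⊕x<x) = *<* (+-cancelʳ-< (a * b) (c * b) (a * d) (begin-strict
    c * b + a * b   ≡⟨ *-distribʳ-+ b c a ⟨
    (c + a) * b     <⟨ y⊕x<x ⟩
    a * (d + b)     ≡⟨ *-distribˡ-+ a d b ⟩
    a * d + a * b   ∎))
    where open ≤-Reasoning

  ≤ᶠ⊕⇒⊕≤ᶠ : ∀ x y → y ≤ᶠ x ⊕ y → x ⊕ y ≤ᶠ x
  ≤ᶠ⊕⇒⊕≤ᶠ (a , b) (c , d) (*≤* y≤x⊕y) = *≤* (begin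
    (a + c) * b     ≡⟨ *-distribʳ-+ b a c ⟩
    a * b + c * b   ≤⟨ +-monoʳ-≤ (a * b) c*b≤a*d ⟩
    a * b + a * d   ≡⟨ *-distribˡ-+ a b d ⟨
    a * (b + d)     ∎)
    where
    open ≤-Reasoning
    c*b≤a*d : c * b ≤ a * d
    c*b≤a*d = +-cancelʳ-≤ (c * d) (c * b) (a * d) (begin
      c * b + c * d   ≡⟨ *-distribˡ-+ c b d ⟨
      c * (b + d)     ≤⟨ y≤x⊕y ⟩
      (a + c) * d     ≡⟨ *-distribʳ-+ d a c ⟩
      a * d + c * d   ∎)

  ≤ᶠ⇔≤ℚ : ∀ {a b c d} → 0 < b → 0 < d → (a , b) ≤ᶠ (c , d) ⇔ frac a b ≤ℚ frac c d
  ≤ᶠ⇔≤ℚ {a} {suc b} {c} {suc d} _ _ = mk⇔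
    (λ { (*≤* x≤y) → toℚᵘ-cancel-≤ (ℚᵘP.≤-respʳ-≃ (ℚᵘP.≃-sym (toℚᵘ-frac c d))
           (ℚᵘP.≤-respˡ-≃ (ℚᵘP.≃-sym (toℚᵘ-frac a b))
           (ℚᵘ.*≤* (subst₂ ℤ._≤_ (ℤP.pos-* a (suc d)) (ℤP.pos-* c (suc b)) (ℤ.+≤+ x≤y))))) })
    (λ x≤y → *≤* (ℤP.drop‿+≤+ (subst₂ ℤ._≤_ (sym (ℤP.pos-* a (suc d))) (sym (ℤP.pos-* c (suc b)))
           (ℚᵘP.drop-*≤* (ℚᵘP.≤-respʳ-≃ (toℚᵘ-frac c d)
             (ℚᵘP.≤-respˡ-≃ (toℚᵘ-frac a b) (toℚᵘ-mono-≤ x≤y)))))))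
    where
    toℚᵘ-frac : ∀ e f → toℚᵘ (frac e (suc f)) ℚᵘ.≃ mkℚᵘ (ℤ.+ e) f
    toℚᵘ-frac e f = toℚᵘ-fromℚᵘ (mkℚᵘ (ℤ.+ e) f)

  <ᶠ⇔<ℚ : ∀ {a b c d} → 0 < b → 0 < d → (a , b) <ᶠ (c , d) ⇔ frac a b <ℚ frac c d
  <ᶠ⇔<ℚ 0<b 0<d = mk⇔
    (λ { (*<* x<y) → ℚP.≰⇒> λ y≤x → case Equivalence.from (≤ᶠ⇔≤ℚ 0<d 0<b) y≤x of λ
           { (*≤* y≤x) → <⇒≱ x<y y≤x } })
    (λ x<y → *<* (≰⇒> λ y≤x →
           ℚP.<-irrefl refl (ℚP.<-≤-trans x<y (Equivalence.to (≤ᶠ⇔≤ℚ 0<d 0<b) (*≤* y≤x)))))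

  ½*frac≡frac : ∀ a b → ½ *ℚ frac a (suc b) ≡ frac a (2 * suc b)
  ½*frac≡frac a b = toℚᵘ-injective (begin
    toℚᵘ (½ *ℚ frac a (suc b))
      ≈⟨ toℚᵘ-homo-* ½ (frac a (suc b)) ⟩
    mkℚᵘ (ℤ.+ 1) 1 ℚᵘ.* toℚᵘ (frac a (suc b))
      ≈⟨ ℚᵘP.*-congˡ {mkℚᵘ (ℤ.+ 1) 1} (toℚᵘ-fromℚᵘ (mkℚᵘ (ℤ.+ a) b)) ⟩
    mkℚᵘ (ℤ.+ 1) 1 ℚᵘ.* mkℚᵘ (ℤ.+ a) b
      ≈⟨ ℚᵘ.*≡* (cong (ℤ._* ℤ.+ (2 * suc b)) (ℤP.*-identityˡ (ℤ.+ a))) ⟩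
    mkℚᵘ (ℤ.+ a) (b + suc (b + 0))
      ≈⟨ toℚᵘ-fromℚᵘ (mkℚᵘ (ℤ.+ a) (b + suc (b + 0))) ⟨
    toℚᵘ (frac a (2 * suc b))
      ∎)
    where open ℚᵘP.≃-Reasoning

  ½*frac≤frac : ∀ {a b c r t} → 0 < b → 0 < r → (a , b) ≤ᶠ (t , 1) → t * r ≤ 2 * c →
                ½ *ℚ frac a b ≤ℚ frac c r
  ½*frac≤frac {a} {suc b} {c} {r} {t} _ 0<r (*≤* a≤t*b) t*r≤2c =
    subst (_≤ℚ frac c r) (sym (½*frac≡frac a b))
      (Equivalence.to (≤ᶠ⇔≤ℚ {a} {2 * suc b} {c} {r} z<s 0<r) (*≤* (begin
        a * r               ≡⟨ cong (_* r) (*-identityʳ a) ⟨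
        a * 1 * r           ≤⟨ *-monoˡ-≤ r a≤t*b ⟩
        t * suc b * r       ≡⟨ *-right-comm t (suc b) r ⟩
        t * r * suc b       ≤⟨ *-monoˡ-≤ (suc b) t*r≤2c ⟩
        2 * c * suc b       ≡⟨ cong (_* suc b) (*-comm 2 c) ⟩
        c * 2 * suc b       ≡⟨ *-assoc c 2 (suc b) ⟩
        c * (2 * suc b)     ∎)))
    where open ≤-Reasoning

  -- Edge counts and degrees

  arc : Graph n → Fin n → Fin n → ℕ
  arc G x y = b2n ((toℕ x <ᵇ toℕ y) ∧ adj G x y)

  arcSum : Graph n → (Fin n → Fin n → ℕ) → ℕ
  arcSum G f = sum λ x → sum λ y → arc G x y * f x y

  edges : Graph n → Subset n → ℕ
  edges G P = arcSum G λ x y → b2n (mem P x ∧ mem P y)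

  degSum : Graph n → Subset n → Subset n → ℕ
  degSum G W X = sum λ x → b2n (mem X x) * degIn G W x

  module _ {n} (G : Graph n) where

    arcSum-cong : {f g : Fin n → Fin n → ℕ} → (∀ x y → f x y ≡ g x y) → arcSum G f ≡ arcSum G g
    arcSum-cong f≡g = sum-cong-≗ λ x → sum-cong-≗ λ y → cong (arc G x y *_) (f≡g x y)

    arcSum-mono-≤ : {f g : Fin n → Fin n → ℕ} → (∀ x y → f x y ≤ g x y) → arcSum G f ≤ arcSum G g
    arcSum-mono-≤ f≤g = sum-mono-≤ λ x → sum-mono-≤ λ y → *-monoʳ-≤ (arc G x y) (f≤g x y)

    arcSum-+ : ∀ (f g : Fin n → Fin n → ℕ) →
               arcSum G (λ x y → f x y + g x y) ≡ arcSum G f + arcSum G g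
    arcSum-+ f g =
      trans (sum-cong-≗ λ x → trans (sum-cong-≗ λ y → *-distribˡ-+ (arc G x y) (f x y) (g x y))
                                   (∑-distrib-+ {n} _ _))
            (∑-distrib-+ {n} _ _)

    adj≡arc+arc : ∀ x y → b2n (adj G x y) ≡ arc G x y + arc G y x
    adj≡arc+arc x y with <-cmp (toℕ x) (toℕ y)
    ... | tri< x<y _ y≮x rewrite <ᵇ≡true x<y | <ᵇ≡false y≮x = sym (+-identityʳ _)
    ... | tri> x≮y _ y<x rewrite <ᵇ≡true y<x | <ᵇ≡false x≮y | Graph.sym G x y = refl
    ... | tri≈ x≮y x≡y _ rewrite toℕ-injective x≡y | <ᵇ≡false x≮y | irrefl G y = refl

    emCount-+-edges : ∀ X Y → emCount G X Y + edges G Y ≡ edges G (X ∪ Y)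
    emCount-+-edges X Y = begin
      emCount G X Y + edges G Y
        ≡⟨ cong (_+ edges G Y) emCount≡arcSum ⟩
      arcSum G (λ x y → b2n (counted x y)) + edges G Y
        ≡⟨ arcSum-+ _ _ ⟨
      arcSum G (λ x y → b2n (counted x y) + b2n (mem Y x ∧ mem Y y))
        ≡⟨ arcSum-cong pointwise ⟩
      edges G (X ∪ Y) ∎
      where
      open ≡-Reasoning
      D = X ─ Y
      counted : Fin n → Fin n → Bool
      counted x y = (mem D x ∧ (mem D y ∨ mem Y y)) ∨ (mem D y ∧ (mem D x ∨ mem Y x))
      b2n-∧-∧ : ∀ a b c → b2n (a ∧ b ∧ c) ≡ b2n (a ∧ b) * b2n c
      b2n-∧-∧ true  true  c = sym (*-identityˡ (b2n c))
      b2n-∧-∧ true  false c = refl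
      b2n-∧-∧ false b     c = refl
      emCount≡arcSum : emCount G X Y ≡ arcSum G (λ x y → b2n (counted x y))
      emCount≡arcSum = trans (sumFin≡sum n _) (sum-cong-≗ λ x →
        trans (sumFin≡sum n _) (sum-cong-≗ λ y → b2n-∧-∧ (toℕ x <ᵇ toℕ y) (adj G x y) (counted x y)))
      table : ∀ a b a′ b′ →
        b2n (((a ∧ not b) ∧ ((a′ ∧ not b′) ∨ b′)) ∨ ((a′ ∧ not b′) ∧ ((a ∧ not b) ∨ b))) + b2n (b ∧ b′)
          ≡ b2n ((a ∨ b) ∧ (a′ ∨ b′))
      table = by-truth-table λ _ _ _ _ → _ ≟ _
      pointwise : ∀ x y → b2n (counted x y) + b2n (mem Y x ∧ mem Y y)
                        ≡ b2n (mem (X ∪ Y) x ∧ mem (X ∪ Y) y)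
      pointwise x y rewrite mem-─ X Y x | mem-─ X Y y | mem-∪ X Y x | mem-∪ X Y y =
        table (mem X x) (mem Y x) (mem X y) (mem Y y)

    edges-supermodular : ∀ P Q → edges G P + edges G Q ≤ edges G (P ∪ Q) + edges G (P ∩ Q)
    edges-supermodular P Q = begin
      edges G P + edges G Q
        ≡⟨ arcSum-+ _ _ ⟨
      arcSum G (λ x y → b2n (mem P x ∧ mem P y) + b2n (mem Q x ∧ mem Q y))
        ≤⟨ arcSum-mono-≤ pointwise ⟩
      arcSum G (λ x y → b2n (mem (P ∪ Q) x ∧ mem (P ∪ Q) y) + b2n (mem (P ∩ Q) x ∧ mem (P ∩ Q) y))
        ≡⟨ arcSum-+ _ _ ⟩
      edges G (P ∪ Q) + edges G (P ∩ Q) ∎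
      where
      open ≤-Reasoning
      table : ∀ p p′ q q′ →
        b2n (p ∧ p′) + b2n (q ∧ q′) ≤ b2n ((p ∨ q) ∧ (p′ ∨ q′)) + b2n ((p ∧ q) ∧ (p′ ∧ q′))
      table = by-truth-table λ _ _ _ _ → _ ≤? _
      pointwise : ∀ x y → b2n (mem P x ∧ mem P y) + b2n (mem Q x ∧ mem Q y)
                        ≤ b2n (mem (P ∪ Q) x ∧ mem (P ∪ Q) y) + b2n (mem (P ∩ Q) x ∧ mem (P ∩ Q) y)
      pointwise x y rewrite mem-∪ P Q x | mem-∪ P Q y | mem-∩ P Q x | mem-∩ P Q y =
        table (mem P x) (mem P y) (mem Q x) (mem Q y)

    degIn-mono : ∀ {U W} v → U ⊆ W → degIn G U v ≤ degIn G W v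
    degIn-mono {U} {W} v U⊆W = begin
      degIn G U v                               ≡⟨ sumFin≡sum n _ ⟩
      sum (λ w → b2n (mem U w ∧ adj G v w))     ≤⟨ sum-mono-≤ (λ w → pointwise (⊆⇒mem-≤ U⊆W w)) ⟩
      sum (λ w → b2n (mem W w ∧ adj G v w))     ≡⟨ sumFin≡sum n _ ⟨
      degIn G W v                               ∎
      where
      open ≤-Reasoning
      pointwise : ∀ {u w e} → u ≤ᴮ w → b2n (u ∧ e) ≤ b2n (w ∧ e)
      pointwise f≤t = z≤n
      pointwise b≤b = ≤-refl

    degSum-⁅⁆ : ∀ W v → degSum G W ⁅ v ⁆ ≡ degIn G W v
    degSum-⁅⁆ W v = sum-⁅⁆ v (degIn G W)
      where
      sum-∅ : ∀ m (f : Fin m → ℕ) → sum (λ x → b2n (mem (∅ {m}) x) * f x) ≡ 0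
      sum-∅ zero    f = refl
      sum-∅ (suc m) f = sum-∅ m (f ∘ suc)
      sum-⁅⁆ : ∀ {m} (v : Fin m) (f : Fin m → ℕ) → sum (λ x → b2n (mem ⁅ v ⁆ x) * f x) ≡ f v
      sum-⁅⁆ {suc m} zero    f =
        trans (cong₂ _+_ (+-identityʳ (f zero)) (sum-∅ m (f ∘ suc))) (+-identityʳ (f zero))
      sum-⁅⁆ {suc m} (suc v) f = sum-⁅⁆ v (f ∘ suc)

    degSum≡arcSum : ∀ W X →
      degSum G W X ≡ arcSum G (λ x y → b2n (mem X x ∧ mem W y) + b2n (mem W x ∧ mem X y))
    degSum≡arcSum W X = begin
      degSum G W X
        ≡⟨ sum-cong-≗ {n} (λ x → trans (cong (b2n (mem X x) *_) (sumFin≡sum n _))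
                                       (*-distribˡ-sum {n} (b2n (mem X x)) _)) ⟩
      sum (λ x → sum λ y → b2n (mem X x) * b2n (mem W y ∧ adj G x y))
        ≡⟨ sum-cong-≗ {n} (λ x → sum-cong-≗ {n} λ y → pointwise x y) ⟩
      sum (λ x → sum λ y → arc G x y * in-X×W x y + arc G y x * in-X×W x y)
        ≡⟨ sum-cong-≗ {n} (λ x → ∑-distrib-+ {n} _ _) ⟩
      sum (λ x → sum (λ y → arc G x y * in-X×W x y) + sum (λ y → arc G y x * in-X×W x y))
        ≡⟨ ∑-distrib-+ {n} _ _ ⟩
      arcSum G in-X×W + sum (λ x → sum λ y → arc G y x * in-X×W x y)
        ≡⟨ cong (arcSum G in-X×W +_) transposed ⟩
      arcSum G in-X×W + arcSum G (λ x y → b2n (mem W x ∧ mem X y))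
        ≡⟨ arcSum-+ _ _ ⟨
      arcSum G (λ x y → b2n (mem X x ∧ mem W y) + b2n (mem W x ∧ mem X y)) ∎
      where
      open ≡-Reasoning
      in-X×W : Fin n → Fin n → ℕ
      in-X×W x y = b2n (mem X x ∧ mem W y)
      factor : ∀ a w e → b2n a * b2n (w ∧ e) ≡ b2n e * b2n (a ∧ w)
      factor false w     e = sym (*-zeroʳ (b2n e))
      factor true  false e = sym (*-zeroʳ (b2n e))
      factor true  true  e = trans (+-identityʳ (b2n e)) (sym (*-identityʳ (b2n e)))
      pointwise : ∀ x y → b2n (mem X x) * b2n (mem W y ∧ adj G x y)
                        ≡ arc G x y * in-X×W x y + arc G y x * in-X×W x y
      pointwise x y = trans (factor (mem X x) (mem W y) (adj G x y))
        (trans (cong (_* in-X×W x y) (adj≡arc+arc x y)) (*-distribʳ-+ _ (arc G x y) _))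
      transposed : sum (λ x → sum λ y → arc G y x * in-X×W x y)
                 ≡ arcSum G (λ x y → b2n (mem W x ∧ mem X y))
      transposed = trans (∑-comm {n} {n} _) (sum-cong-≗ λ x → sum-cong-≗ λ y →
                     cong (λ b → arc G x y * b2n b) (∧-comm (mem X y) (mem W x)))

    edges≤edges+degSum : ∀ W U → edges G W ≤ edges G U + degSum G W (W ─ U)
    edges≤edges+degSum W U = begin
      edges G W
        ≤⟨ arcSum-mono-≤ pointwise ⟩
      arcSum G (λ x y → b2n (mem U x ∧ mem U y) + (b2n (mem D x ∧ mem W y) + b2n (mem W x ∧ mem D y)))
        ≡⟨ arcSum-+ _ _ ⟩
      edges G U + arcSum G (λ x y → b2n (mem D x ∧ mem W y) + b2n (mem W x ∧ mem D y))
        ≡⟨ cong (edges G U +_) (degSum≡arcSum W D) ⟨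
      edges G U + degSum G W D ∎
      where
      open ≤-Reasoning
      D = W ─ U
      table : ∀ u w u′ w′ →
        b2n (w ∧ w′) ≤ b2n (u ∧ u′) + (b2n ((w ∧ not u) ∧ w′) + b2n (w ∧ (w′ ∧ not u′)))
      table = by-truth-table λ _ _ _ _ → _ ≤? _
      pointwise : ∀ x y → b2n (mem W x ∧ mem W y)
                        ≤ b2n (mem U x ∧ mem U y) + (b2n (mem D x ∧ mem W y) + b2n (mem W x ∧ mem D y))
      pointwise x y rewrite mem-─ W U x | mem-─ W U y = table (mem U x) (mem W x) (mem U y) (mem W y)

    degSum+edges≤edges : ∀ {U W} → U ⊆ W →
      degSum G W (W ─ U) + (edges G U + edges G U) ≤ edges G W + edges G W
    degSum+edges≤edges {U} {W} U⊆W = begin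
      degSum G W D + (edges G U + edges G U)
        ≡⟨ cong₂ _+_ (degSum≡arcSum W D) (sym (arcSum-+ _ _)) ⟩
      arcSum G (λ x y → b2n (mem D x ∧ mem W y) + b2n (mem W x ∧ mem D y))
        + arcSum G (λ x y → b2n (mem U x ∧ mem U y) + b2n (mem U x ∧ mem U y))
        ≡⟨ arcSum-+ _ _ ⟨
      arcSum G (λ x y → (b2n (mem D x ∧ mem W y) + b2n (mem W x ∧ mem D y))
                        + (b2n (mem U x ∧ mem U y) + b2n (mem U x ∧ mem U y)))
        ≤⟨ arcSum-mono-≤ pointwise ⟩
      arcSum G (λ x y → b2n (mem W x ∧ mem W y) + b2n (mem W x ∧ mem W y))
        ≡⟨ arcSum-+ _ _ ⟩
      edges G W + edges G W ∎
      where
      open ≤-Reasoning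
      D = W ─ U
      table : ∀ u w u′ w′ → u ≤ᴮ w → u′ ≤ᴮ w′ →
        (b2n ((w ∧ not u) ∧ w′) + b2n (w ∧ (w′ ∧ not u′))) + (b2n (u ∧ u′) + b2n (u ∧ u′))
          ≤ b2n (w ∧ w′) + b2n (w ∧ w′)
      table = by-truth-table λ _ _ _ _ → _ ≤ᴮ? _ →-dec _ ≤ᴮ? _ →-dec _ ≤? _
      pointwise : ∀ x y → (b2n (mem D x ∧ mem W y) + b2n (mem W x ∧ mem D y))
                          + (b2n (mem U x ∧ mem U y) + b2n (mem U x ∧ mem U y))
                        ≤ b2n (mem W x ∧ mem W y) + b2n (mem W x ∧ mem W y)
      pointwise x y rewrite mem-─ W U x | mem-─ W U y =
        table (mem U x) (mem W x) (mem U y) (mem W y) (⊆⇒mem-≤ U⊆W x) (⊆⇒mem-≤ U⊆W y)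

  ρ : Graph n → Subset n → Subset n → Frac
  ρ G W U = emCount G W U , ∣ W ─ U ∣

  module _ {n} (G : Graph n) where

    emCount+edges≡edges : ∀ {U W} → U ⊆ W → emCount G W U + edges G U ≡ edges G W
    emCount+edges≡edges {U} {W} U⊆W = trans (emCount-+-edges G W U) (cong (edges G) (p⊆q⇒q∪p≡q U⊆W))

    emCount-self : ∀ W → emCount G W W ≡ 0
    emCount-self W = +-cancelʳ-≡ (edges G W) (emCount G W W) 0 (emCount+edges≡edges {W} ⊆-refl)

    emCount-trans : ∀ {U V W} → U ⊆ V → V ⊆ W → emCount G W U ≡ emCount G W V + emCount G V U
    emCount-trans {U} {V} {W} U⊆V V⊆W = +-cancelʳ-≡ (edges G U) _ _ (begin
      emCount G W U + edges G U                   ≡⟨ emCount+edges≡edges (⊆-trans U⊆V V⊆W) ⟩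
      edges G W                                   ≡⟨ emCount+edges≡edges V⊆W ⟨
      emCount G W V + edges G V                   ≡⟨ cong (emCount G W V +_) (emCount+edges≡edges U⊆V) ⟨
      emCount G W V + (emCount G V U + edges G U) ≡⟨ +-assoc (emCount G W V) _ _ ⟨
      emCount G W V + emCount G V U + edges G U   ∎)
      where open ≡-Reasoning

    emCount-supermodular : ∀ P Q → emCount G P (P ∩ Q) ≤ emCount G (P ∪ Q) Q
    emCount-supermodular P Q = +-cancelʳ-≤ (e∩ + eQ) _ _ (begin
      g₁ + (e∩ + eQ)         ≡⟨ +-assoc g₁ e∩ eQ ⟨
      (g₁ + e∩) + eQ         ≡⟨ cong (_+ eQ) (emCount+edges≡edges (p∩q⊆p P Q)) ⟩
      edges G P + eQ         ≤⟨ edges-supermodular G P Q ⟩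
      edges G (P ∪ Q) + e∩   ≡⟨ cong (_+ e∩) (emCount+edges≡edges (q⊆p∪q P Q)) ⟨
      (g₂ + eQ) + e∩         ≡⟨ +-assoc g₂ eQ e∩ ⟩
      g₂ + (eQ + e∩)         ≡⟨ cong (g₂ +_) (+-comm eQ e∩) ⟩
      g₂ + (e∩ + eQ)         ∎)
      where
      open ≤-Reasoning
      g₁ = emCount G P (P ∩ Q)
      g₂ = emCount G (P ∪ Q) Q
      e∩ = edges G (P ∩ Q)
      eQ = edges G Q

    emCount≤degSum : ∀ {U W} → U ⊆ W → emCount G W U ≤ degSum G W (W ─ U)
    emCount≤degSum {U} {W} U⊆W = +-cancelʳ-≤ (edges G U) _ _ (begin
      emCount G W U + edges G U        ≡⟨ emCount+edges≡edges U⊆W ⟩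
      edges G W                        ≤⟨ edges≤edges+degSum G W U ⟩
      edges G U + degSum G W (W ─ U)   ≡⟨ +-comm (edges G U) _ ⟩
      degSum G W (W ─ U) + edges G U   ∎)
      where open ≤-Reasoning

    degSum≤2*emCount : ∀ {U W} → U ⊆ W → degSum G W (W ─ U) ≤ 2 * emCount G W U
    degSum≤2*emCount {U} {W} U⊆W = +-cancelʳ-≤ (e + e) _ _ (begin
      degSum G W (W ─ U) + (e + e) ≤⟨ degSum+edges≤edges G U⊆W ⟩
      edges G W + edges G W        ≡⟨ cong₂ _+_ (emCount+edges≡edges U⊆W) (emCount+edges≡edges U⊆W) ⟨
      (g + e) + (g + e)            ≡⟨ +-interchange g e g e ⟩
      (g + g) + (e + e)            ≡⟨ cong (λ h → (g + h) + (e + e)) (+-identityʳ g) ⟨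
      2 * g + (e + e)              ∎)
      where
      open ≤-Reasoning
      g = emCount G W U
      e = edges G U

    emCount[W,W-v]≤degIn : ∀ {v W} → v ∈ W → emCount G W (W - v) ≤ degIn G W v
    emCount[W,W-v]≤degIn {v} {W} v∈W = begin
      emCount G W (W - v)          ≤⟨ emCount≤degSum (p─q⊆p W ⁅ v ⁆) ⟩
      degSum G W (W ─ (W - v))     ≡⟨ cong (degSum G W) (p─[p─q]≡q (x∈p⇒⁅x⁆⊆p v∈W)) ⟩
      degSum G W ⁅ v ⁆             ≡⟨ degSum-⁅⁆ G W v ⟩
      degIn G W v                  ∎
      where open ≤-Reasoning

    ρ-trans : ∀ {U V W} → U ⊆ V → V ⊆ W → ρ G W U ≡ ρ G W V ⊕ ρ G V U
    ρ-trans U⊆V V⊆W = cong₂ _,_ (emCount-trans U⊆V V⊆W) (∣r─p∣≡∣r─q∣+∣q─p∣ U⊆V V⊆W)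

    ρ-self : ∀ W → ρ G W W ≡ 0ᶠ
    ρ-self W = cong₂ _,_ (emCount-self W) (∣p─p∣≡0 W)

    ρ[W,W-v] : ∀ {v W} → v ∈ W → ρ G W (W - v) ≡ (emCount G W (W - v) , 1)
    ρ[W,W-v] {v} {W} v∈W =
      cong (emCount G W (W - v) ,_) (trans (cong ∣_∣ (p─[p─q]≡q (x∈p⇒⁅x⁆⊆p v∈W))) (∣⁅x⁆∣≡1 v))

    d[p─q,q]≡d[p,q] : ∀ p q → d G (p ─ q) q ≡ d G p q
    d[p─q,q]≡d[p,q] p q rewrite p─q─q≡p─q p q = refl

    locallyDense-elim : ∀ {Q W V} → LocallyDense G W → Q ⊂ W → W ⊂ V → ρ G V W <ᶠ ρ G W Q
    locallyDense-elim {Q} {W} {V} W-dense Q⊂W@(Q⊆W , x , x∈W , x∉Q) W⊂V@(_ , y , y∈V , y∉W) =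
      Equivalence.from (<ᶠ⇔<ℚ (p⊂q⇒∣q─p∣>0 W⊂V) (p⊂q⇒∣q─p∣>0 Q⊂W)) (ℚP.≰⇒> λ dWQ≤dVW →
        W-dense (W ─ Q , V ─ W , (x , x∈p∧x∉q⇒x∈p─q x∈W x∉Q) , p─q⊆p W Q ,
                 (y , x∈p∧x∉q⇒x∈p─q y∈V y∉W) , disjoint , subst₂ _≤ℚ_ d-inner d-outer dWQ≤dVW))
      where
      disjoint : Empty ((V ─ W) ∩ W)
      disjoint (z , z∈) = let z∈V─W , z∈W = x∈p∩q⁻ (V ─ W) W z∈ in x∈p─q⇒x∉q z∈V─W z∈W
      d-inner : d G W Q ≡ d G (W ─ Q) (W ─ (W ─ Q))
      d-inner = trans (sym (d[p─q,q]≡d[p,q] W Q)) (cong (d G (W ─ Q)) (sym (p─[p─q]≡q Q⊆W)))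
      d-outer : d G V W ≡ d G (V ─ W) W
      d-outer = sym (d[p─q,q]≡d[p,q] V W)

    locallyDense-intro : ∀ {W} (r : Frac) →
      (∀ {Q} → Q ⊂ W → r ≤ᶠ ρ G W Q) → (∀ {V} → W ⊂ V → ρ G V W <ᶠ r) → LocallyDense G W
    locallyDense-intro {W} r above below (X , Y , (x , x∈X) , X⊆W , (y , y∈Y) , Y∩W-empty , dX≤dY) =
      <ᶠ-irrefl (<ᶠ-≤ᶠ-trans (p⊂q⇒∣q─p∣>0 W⊂W∪Y)
        (<ᶠ-≤ᶠ-trans (p⊂q⇒∣q─p∣>0 W─X⊂W) (below W⊂W∪Y) (above W─X⊂W))
        (Equivalence.from (≤ᶠ⇔≤ℚ (p⊂q⇒∣q─p∣>0 W─X⊂W) (p⊂q⇒∣q─p∣>0 W⊂W∪Y))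
          (subst₂ _≤ℚ_ d-inner d-outer dX≤dY)))
      where
      W─X⊂W : W ─ X ⊂ W
      W─X⊂W = p─q⊆p W X , x , X⊆W x∈X , λ x∈W─X → x∈p─q⇒x∉q x∈W─X x∈X
      W⊂W∪Y : W ⊂ W ∪ Y
      W⊂W∪Y = p⊆p∪q Y , y , q⊆p∪q W Y y∈Y , λ y∈W → Y∩W-empty (y , x∈p∩q⁺ (y∈Y , y∈W))
      d-inner : d G X (W ─ X) ≡ d G W (W ─ X)
      d-inner = trans (cong (λ Z → d G Z (W ─ X)) (sym (p─[p─q]≡q X⊆W))) (d[p─q,q]≡d[p,q] W (W ─ X))
      d-outer : d G Y W ≡ d G (W ∪ Y) W
      d-outer = begin
        d G Y W              ≡⟨ d[p─q,q]≡d[p,q] Y W ⟨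
        d G (Y ─ W) W        ≡⟨ cong (λ Z → d G Z W) ([p∪q]─q≡p─q Y W) ⟨
        d G ((Y ∪ W) ─ W) W  ≡⟨ cong (λ Z → d G (Z ─ W) W) (∪-comm Y W) ⟩
        d G ((W ∪ Y) ─ W) W  ≡⟨ d[p─q,q]≡d[p,q] (W ∪ Y) W ⟩
        d G (W ∪ Y) W        ∎
        where open ≡-Reasoning

  -- Densest extensions

  module DensestExtension {n} (G : Graph n) {A S : Subset n} (A⊂S : A ⊂ S)
    (A-dense : LocallyDense G A) (S-dense : LocallyDense G S)
    (dense-between⇒S : ∀ {W} → A ⊂ W → W ⊆ S → LocallyDense G W → S ⊆ W) where

    Candidate : Subset n → Set
    Candidate W = A ⊂ W × W ⊆ S

    candidate? : ∀ W → Dec (Candidate W)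
    candidate? W = A ⊂? W ×-dec W ⊆? S

    score : Subset n → ℚ × ℕ
    score W = d G W A , ∣ W ∣

    module Lex = TotalOrder (×-totalOrder ℚP.≤-decTotalOrder ≤-totalOrder)
    open Extrema (×-totalOrder ℚP.≤-decTotalOrder ≤-totalOrder)
      using (argmax; argmax-all; f[xs]≤f[argmax])

    W★ : Subset n
    W★ = argmax score S (filter candidate? (allSubsets n))

    W★-candidate : Candidate W★
    W★-candidate =
      argmax-all score {P = Candidate} (A⊂S , ⊆-refl) (all-filter candidate? (allSubsets n))

    A⊂W★ : A ⊂ W★
    A⊂W★ = proj₁ W★-candidate

    W★⊆S : W★ ⊆ S
    W★⊆S = proj₂ W★-candidate

    ρ★ : Frac
    ρ★ = ρ G W★ A

    0<den★ : 0 < proj₂ ρ★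
    0<den★ = p⊂q⇒∣q─p∣>0 A⊂W★

    W★-maximal : ∀ {Z} → Candidate Z → Lex._≤_ (score Z) (score W★)
    W★-maximal {Z} Z-candidate =
      All.lookup (f[xs]≤f[argmax] S _) (∈-filter⁺ candidate? (∈-allSubsets Z) Z-candidate)

    d-maximal : ∀ {Z} → Candidate Z → (d G Z A <ℚ d G W★ A) ⊎ (d G Z A ≡ d G W★ A × ∣ Z ∣ ≤ ∣ W★ ∣)
    d-maximal Z-candidate = from-lex (W★-maximal Z-candidate)
      where
      from-lex : ∀ {q r : ℚ} {k l : ℕ} → Lex._≤_ (q , k) (r , l) → (q <ℚ r) ⊎ (q ≡ r × k ≤ l)
      from-lex (inj₁ (q≤r , q≢r)) = inj₁ (ℚP.≰⇒> λ r≤q → q≢r (ℚP.≤-antisym q≤r r≤q))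
      from-lex (inj₂ q≡r×k≤l)    = inj₂ q≡r×k≤l

    ρ-maximal : ∀ {Z} → A ⊆ Z → Z ⊆ S → ρ G Z A ≤ᶠ ρ★
    ρ-maximal {Z} A⊆Z Z⊆S = cases (⊆⇒≡⊎⊂ A⊆Z)
      where
      d≤ : (d G Z A <ℚ d G W★ A) ⊎ (d G Z A ≡ d G W★ A × ∣ Z ∣ ≤ ∣ W★ ∣) → d G Z A ≤ℚ d G W★ A
      d≤ (inj₁ d<d)       = ℚP.<⇒≤ d<d
      d≤ (inj₂ (d≡d , _)) = ℚP.≤-reflexive d≡d
      cases : A ≡ Z ⊎ A ⊂ Z → ρ G Z A ≤ᶠ ρ★
      cases (inj₁ A≡Z) =
        subst (λ T → ρ G T A ≤ᶠ ρ★) A≡Z (subst (_≤ᶠ ρ★) (sym (ρ-self G A)) 0ᶠ≤ᶠ)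
      cases (inj₂ A⊂Z) =
        Equivalence.from (≤ᶠ⇔≤ℚ (p⊂q⇒∣q─p∣>0 A⊂Z) 0<den★) (d≤ (d-maximal (A⊂Z , Z⊆S)))

    ρ-maximal-strict : ∀ {Z} → A ⊂ Z → Z ⊆ S → ∣ W★ ∣ < ∣ Z ∣ → ρ G Z A <ᶠ ρ★
    ρ-maximal-strict {Z} A⊂Z Z⊆S ∣W★∣<∣Z∣ =
      Equivalence.from (<ᶠ⇔<ℚ (p⊂q⇒∣q─p∣>0 A⊂Z) 0<den★) (d< (d-maximal (A⊂Z , Z⊆S)))
      where
      d< : (d G Z A <ℚ d G W★ A) ⊎ (d G Z A ≡ d G W★ A × ∣ Z ∣ ≤ ∣ W★ ∣) → d G Z A <ℚ d G W★ A
      d< (inj₁ d<d)             = d<d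
      d< (inj₂ (_ , ∣Z∣≤∣W★∣)) = ⊥-elim (<⇒≱ ∣W★∣<∣Z∣ ∣Z∣≤∣W★∣)

    below-extensions : ∀ {V} → W★ ⊂ V → ρ G V W★ <ᶠ ρ★
    below-extensions {V} W★⊂V@(W★⊆V , _) =
      subst (_<ᶠ ρ★) (sym split) (mediant-<ᶠ 0<den outer inner)
      where
      I = V ∩ S
      W★⊆I : W★ ⊆ I
      W★⊆I x∈W★ = x∈p∩q⁺ (W★⊆V x∈W★ , W★⊆S x∈W★)
      split : ρ G V W★ ≡ ρ G V I ⊕ ρ G I W★
      split = ρ-trans G W★⊆I (p∩q⊆p V S)
      0<den : 0 < proj₂ (ρ G V I ⊕ ρ G I W★)
      0<den = subst (λ r → 0 < proj₂ r) split (p⊂q⇒∣q─p∣>0 W★⊂V)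
      outside-S : S ≡ V ∪ S ⊎ S ⊂ V ∪ S → ρ G (V ∪ S) S <ᶠ⁰ ρ★
      outside-S (inj₁ S≡V∪S) = inj₁ (subst (λ T → ρ G T S ≡ 0ᶠ) S≡V∪S (ρ-self G S))
      outside-S (inj₂ S⊂V∪S) = inj₂ (<ᶠ-≤ᶠ-trans 0<den★
        (locallyDense-elim G S-dense A⊂S S⊂V∪S) (ρ-maximal (proj₁ A⊂S) ⊆-refl))
      same-size : ∣ (V ∪ S) ─ S ∣ ≡ ∣ V ─ I ∣
      same-size = cong ∣_∣ (trans ([p∪q]─q≡p─q V S) (sym (p─[p∩q]≡p─q V S)))
      outer : ρ G V I <ᶠ⁰ ρ★
      outer = <ᶠ⁰-anti-num (emCount-supermodular G V S)
                (subst (λ k → (emCount G (V ∪ S) S , k) <ᶠ⁰ ρ★) same-size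
                  (outside-S (⊆⇒≡⊎⊂ (q⊆p∪q V S))))
      inside-S : W★ ≡ I ⊎ W★ ⊂ I → ρ G I W★ <ᶠ⁰ ρ★
      inside-S (inj₁ W★≡I) = inj₁ (subst (λ T → ρ G T W★ ≡ 0ᶠ) W★≡I (ρ-self G W★))
      inside-S (inj₂ W★⊂I) = inj₂ (⊕<ᶠ⇒<ᶠ ρ★ (ρ G I W★)
        (subst (_<ᶠ ρ★) (ρ-trans G (proj₁ A⊂W★) (proj₁ W★⊂I))
          (ρ-maximal-strict (⊂-⊆-trans A⊂W★ (proj₁ W★⊂I)) (p∩q⊆q V S) (p⊂q⇒∣p∣<∣q∣ W★⊂I))))
      inner : ρ G I W★ <ᶠ⁰ ρ★
      inner = inside-S (⊆⇒≡⊎⊂ W★⊆I)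

    above-restrictions : ∀ {Q} → Q ⊆ W★ → ρ★ ≤ᶠ ρ G W★ Q
    above-restrictions {Q} Q⊆W★ = subst (ρ★ ≤ᶠ_) (sym split) (≤ᶠ-mediant outer inner)
      where
      J = A ∪ Q
      J⊆W★ : J ⊆ W★
      J⊆W★ x∈J = [ proj₁ A⊂W★ , Q⊆W★ ] (x∈p∪q⁻ A Q x∈J)
      split : ρ G W★ Q ≡ ρ G W★ J ⊕ ρ G J Q
      split = ρ-trans G (q⊆p∪q A Q) J⊆W★
      split★ : ρ★ ≡ ρ G W★ J ⊕ ρ G J A
      split★ = ρ-trans G (p⊆p∪q Q) J⊆W★
      outer : ρ★ ≤ᶠ ρ G W★ J
      outer = subst (_≤ᶠ ρ G W★ J) (sym split★) (≤ᶠ⊕⇒⊕≤ᶠ (ρ G W★ J) (ρ G J A)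
                (subst (ρ G J A ≤ᶠ_) split★ (ρ-maximal (p⊆p∪q Q) (⊆-trans J⊆W★ W★⊆S))))
      inside-A : A ∩ Q ≡ A ⊎ A ∩ Q ⊂ A → ρ★ ≤ᶠ ρ G A (A ∩ Q)
      inside-A (inj₁ A∩Q≡A) =
        subst (λ T → ρ★ ≤ᶠ ρ G A T) (sym A∩Q≡A) (subst (ρ★ ≤ᶠ_) (sym (ρ-self G A)) ≤ᶠ0ᶠ)
      inside-A (inj₂ A∩Q⊂A) = <ᶠ⇒≤ᶠ (locallyDense-elim G A-dense A∩Q⊂A A⊂W★)
      same-size : ∣ A ─ (A ∩ Q) ∣ ≡ ∣ J ─ Q ∣
      same-size = cong ∣_∣ (trans (p─[p∩q]≡p─q A Q) (sym ([p∪q]─q≡p─q A Q)))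
      inner : ρ★ ≤ᶠ ρ G J Q
      inner = subst (λ k → ρ★ ≤ᶠ (emCount G J Q , k)) same-size
                (≤ᶠ-mono-num (inside-A (⊆⇒≡⊎⊂ (p∩q⊆p A Q))) (emCount-supermodular G A Q))

    W★-dense : LocallyDense G W★
    W★-dense = locallyDense-intro G ρ★ (above-restrictions ∘ proj₁) below-extensions

    W★≡S : W★ ≡ S
    W★≡S = ⊆-antisym W★⊆S (dense-between⇒S A⊂W★ W★⊆S W★-dense)

    S-densest : ∀ {Z} → A ⊆ Z → Z ⊆ S → ρ G Z A ≤ᶠ ρ G S A
    S-densest {Z} A⊆Z Z⊆S = subst (λ T → ρ G Z A ≤ᶠ ρ G T A) W★≡S (ρ-maximal A⊆Z Z⊆S)

    ρ[S,A]≤degIn : ∀ {v} → v ∈ S → ρ G S A ≤ᶠ (degIn G S v , 1)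
    ρ[S,A]≤degIn {v} v∈S = cases (v ∈? A)
      where
      cases : Dec (v ∈ A) → ρ G S A ≤ᶠ (degIn G S v , 1)
      cases (yes v∈A) =
        ≤ᶠ-mono-num (<ᶠ⇒≤ᶠ (subst (ρ G S A <ᶠ_) (ρ[W,W-v] G v∈A)
                                 (locallyDense-elim G A-dense (x∈p⇒p-x⊂p v∈A) A⊂S)))
                    (≤-trans (emCount[W,W-v]≤degIn G v∈A) (degIn-mono G v (proj₁ A⊂S)))
      cases (no v∉A) =
        ≤ᶠ-mono-num (subst (ρ G S A ≤ᶠ_) (ρ[W,W-v] G v∈S) S≤S-v) (emCount[W,W-v]≤degIn G v∈S)
        where
        A⊆S-v : A ⊆ S - v
        A⊆S-v x∈A = x∈p∧x≢y⇒x∈p-y (proj₁ A⊂S x∈A) λ { refl → v∉A x∈A }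
        split : ρ G S A ≡ ρ G S (S - v) ⊕ ρ G (S - v) A
        split = ρ-trans G A⊆S-v (p─q⊆p S ⁅ v ⁆)
        S≤S-v : ρ G S A ≤ᶠ ρ G S (S - v)
        S≤S-v = subst (_≤ᶠ ρ G S (S - v)) (sym split) (≤ᶠ⊕⇒⊕≤ᶠ (ρ G S (S - v)) (ρ G (S - v) A)
                  (subst (ρ G (S - v) A ≤ᶠ_) split (S-densest A⊆S-v (p─q⊆p S ⁅ v ⁆))))

  -- Cores

  module _ {n} (G : Graph n) where

    MinDeg? : ∀ t X → Dec (MinDeg G t X)
    MinDeg? t X = all? λ v → v ∈? X →-dec t ≤? degIn G X v

    MinDeg-weaken : ∀ {s t X} → s ≤ t → MinDeg G t X → MinDeg G s X
    MinDeg-weaken s≤t X-deg v v∈X = ≤-trans s≤t (X-deg v v∈X)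

    MinDeg-∪ : ∀ {t X Y} → MinDeg G t X → MinDeg G t Y → MinDeg G t (X ∪ Y)
    MinDeg-∪ {t} {X} {Y} X-deg Y-deg v v∈X∪Y = [ from-X , from-Y ] (x∈p∪q⁻ X Y v∈X∪Y)
      where
      from-X : v ∈ X → t ≤ degIn G (X ∪ Y) v
      from-X v∈X = ≤-trans (X-deg v v∈X) (degIn-mono G v (p⊆p∪q {p = X} Y))
      from-Y : v ∈ Y → t ≤ degIn G (X ∪ Y) v
      from-Y v∈Y = ≤-trans (Y-deg v v∈Y) (degIn-mono G v (q⊆p∪q X Y))

    MinDeg-⋃ : ∀ {t Xs} → All (MinDeg G t) Xs → MinDeg G t (⋃ Xs)
    MinDeg-⋃ []               v v∈∅ = ⊥-elim (∉⊥ v∈∅)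
    MinDeg-⋃ (X-deg ∷ Xs-deg) = MinDeg-∪ X-deg (MinDeg-⋃ Xs-deg)

    core-exists : ∀ t → ∃ (IsCore G t)
    core-exists t = ⋃ (filter (MinDeg? t) (allSubsets n)) ,
                    MinDeg-⋃ (all-filter (MinDeg? t) (allSubsets n)) ,
                    λ Y Y-deg → ∈⇒⊆⋃ (∈-filter⁺ (MinDeg? t) (∈-allSubsets Y) Y-deg)

    core-⊆-MinDeg : ∀ {s t C K} → IsCore G s C → C ⊆ K → MinDeg G t K → MinDeg G t C
    core-⊆-MinDeg {s} {t} {C} {K} (C-deg , C-max) C⊆K K-deg with t ≤? s
    ... | yes t≤s = MinDeg-weaken t≤s C-deg
    ... | no  t≰s = λ v v∈C → ≤-trans (K-deg v (C⊆K v∈C)) (degIn-mono G v K⊆C)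
      where
      K⊆C : K ⊆ C
      K⊆C = C-max K (MinDeg-weaken (<⇒≤ (≰⇒> t≰s)) K-deg)

    MinDeg⇒*∣─∣≤2*emCount : ∀ {t U W} → MinDeg G t W → U ⊆ W → t * ∣ W ─ U ∣ ≤ 2 * emCount G W U
    MinDeg⇒*∣─∣≤2*emCount {t} {U} {W} W-deg U⊆W = begin
      t * ∣ W ─ U ∣                         ≡⟨ cong (t *_) (∣p∣≡∑ (W ─ U)) ⟩
      t * sum (λ x → b2n (mem (W ─ U) x))   ≡⟨ *-distribˡ-sum {n} t _ ⟩
      sum (λ x → t * b2n (mem (W ─ U) x))   ≤⟨ sum-mono-≤ pointwise ⟩
      degSum G W (W ─ U)                    ≤⟨ degSum≤2*emCount G U⊆W ⟩
      2 * emCount G W U                     ∎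
      where
      open ≤-Reasoning
      pointwise : ∀ x → t * b2n (mem (W ─ U) x) ≤ b2n (mem (W ─ U) x) * degIn G W x
      pointwise x with mem (W ─ U) x in x∈?W─U
      ... | false = ≤-reflexive (*-zeroʳ t)
      ... | true  = begin
        t * 1                 ≡⟨ *-identityʳ t ⟩
        t                     ≤⟨ W-deg x (p─q⊆p W U (mem⇒∈ x∈?W─U)) ⟩
        degIn G W x           ≡⟨ +-identityʳ _ ⟨
        1 * degIn G W x       ∎

  -- Chains and profiles

  Increasing : ∀ {ℓ} → (Fin (suc ℓ) → Subset n) → Set
  Increasing {ℓ = ℓ} A = ∀ (j : Fin ℓ) → A (inject₁ j) ⊂ A (suc j)

  first⊆ : ∀ {ℓ} (A : Fin (suc ℓ) → Subset n) → Increasing A → ∀ x → A zero ⊆ A x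
  first⊆ {ℓ = zero}  A A↑ zero    = ⊆-refl
  first⊆ {ℓ = suc ℓ} A A↑ zero    = ⊆-refl
  first⊆ {ℓ = suc ℓ} A A↑ (suc x) = ⊆-trans (proj₁ (A↑ zero)) (first⊆ (A ∘ suc) (A↑ ∘ suc) x)

  chain-comparable : ∀ {ℓ} (A : Fin (suc ℓ) → Subset n) → Increasing A →
    ∀ x (j : Fin ℓ) → A x ⊆ A (inject₁ j) ⊎ A (suc j) ⊆ A x
  chain-comparable A A↑ zero    j       = inj₁ (first⊆ A A↑ (inject₁ j))
  chain-comparable A A↑ (suc x) zero    = inj₂ (first⊆ (A ∘ suc) (A↑ ∘ suc) x)
  chain-comparable A A↑ (suc x) (suc j) = chain-comparable (A ∘ suc) (A↑ ∘ suc) x j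

  module _ {n} (G : Graph n) where

    profile-attained : ∀ ℓ (A : Fin (suc ℓ) → Subset n) → Increasing A → ∀ {i} →
      ¬ i ≤ ∣ A zero ∣ → i ≤ ∣ A (fromℕ ℓ) ∣ →
      ∃ λ j → profile G ℓ A i ≡ d G (A (suc j)) (A (inject₁ j))
            × i ≤ ∣ A (suc j) ∣ × (∀ x → i ≤ ∣ A x ∣ → A (suc j) ⊆ A x)
    profile-attained zero    A _  i≰∣A₀∣ i≤∣Aℓ∣ = ⊥-elim (i≰∣A₀∣ i≤∣Aℓ∣)
    profile-attained (suc ℓ) A A↑ {i} i≰∣A₀∣ i≤∣Aℓ∣ with i ≤? ∣ A (suc zero) ∣
    ... | yes i≤∣A₁∣ = zero , refl , i≤∣A₁∣ , λ where
      zero    i≤∣A₀∣ → ⊥-elim (i≰∣A₀∣ i≤∣A₀∣)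
      (suc x) _      → first⊆ (A ∘ suc) (A↑ ∘ suc) x
    ... | no  i≰∣A₁∣ with profile-attained ℓ (A ∘ suc) (A↑ ∘ suc) i≰∣A₁∣ i≤∣Aℓ∣
    ...   | j , p≡ , i≤∣Aⱼ∣ , Aⱼ-least = suc j , p≡ , i≤∣Aⱼ∣ , λ where
      zero    i≤∣A₀∣ → ⊥-elim (i≰∣A₀∣ i≤∣A₀∣)
      (suc x) i≤∣Aₓ∣ → Aⱼ-least x i≤∣Aₓ∣

    profile-spec : ∀ {ℓ} {A : Fin (suc ℓ) → Subset n} → IsChain A → ∀ {i} → 1 ≤ i → i ≤ n →
      ∃ λ j → profile G ℓ A i ≡ d G (A (suc j)) (A (inject₁ j))
            × i ≤ ∣ A (suc j) ∣ × (∀ x → i ≤ ∣ A x ∣ → A (suc j) ⊆ A x)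
    profile-spec {ℓ} {A} (A₀≡∅ , Aℓ≡V , A↑) 1≤i i≤n =
      profile-attained ℓ A A↑
        (λ i≤∣A₀∣ → <⇒≱ 1≤i (≤-trans i≤∣A₀∣ (≤-reflexive (trans (cong ∣_∣ A₀≡∅) (∣⊥∣≡0 n)))))
        (subst (λ Z → _ ≤ ∣ Z ∣) (sym Aℓ≡V) (subst (_ ≤_) (sym (∣⊤∣≡n n)) i≤n))

  module _ {n} (G : Graph n) where

    -- t is ⌈ d(S, A) ⌉.
    locallyDense-layer-minDeg : ∀ {k} {B : Fin (suc k) → Subset n} → IsChain B →
      (∀ W → LocallyDense G W ⇔ ∃ (λ j → B j ≡ W)) → ∀ j →
      ∃ λ t → ρ G (B (suc j)) (B (inject₁ j)) ≤ᶠ (t , 1) × MinDeg G t (B (suc j))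
    locallyDense-layer-minDeg {B = B} (_ , _ , B↑) B-dense j =
      let _ , v , v∈S , _ = A⊂S
          t , ρ≤t , t-least = least-witness (λ t → ρ G S A ≤ᶠ? (t , 1)) _ ≤-refl (ρ[S,A]≤degIn v∈S)
      in  t , ρ≤t , λ w w∈S → t-least (ρ[S,A]≤degIn w∈S)
      where
      A = B (inject₁ j)
      S = B (suc j)
      A⊂S : A ⊂ S
      A⊂S = B↑ j
      dense : ∀ x → LocallyDense G (B x)
      dense x = Equivalence.from (B-dense (B x)) (x , refl)
      dense-between⇒S : ∀ {W} → A ⊂ W → W ⊆ S → LocallyDense G W → S ⊆ W
      dense-between⇒S {W} (_ , w , w∈W , w∉A) _ W-dense with Equivalence.to (B-dense W) W-dense
      ... | x , refl = S⊆ (chain-comparable B B↑ x j)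
        where
        S⊆ : B x ⊆ A ⊎ S ⊆ B x → S ⊆ B x
        S⊆ (inj₁ Bx⊆A) = ⊥-elim (w∉A (Bx⊆A w∈W))
        S⊆ (inj₂ S⊆Bx) = S⊆Bx
      open DensestExtension G A⊂S (dense (inject₁ j)) (dense (suc j)) dense-between⇒S
        using (ρ[S,A]≤degIn)

    core-layer-minDeg : ∀ {l} {C : Fin (suc l) → Subset n} →
      (∀ W → ∃ (λ s → IsCore G s W) ⇔ ∃ (λ x → C x ≡ W)) →
      ∀ {t S i y} → MinDeg G t S → i ≤ ∣ S ∣ → (∀ x → i ≤ ∣ C x ∣ → C y ⊆ C x) → MinDeg G t (C y)
    core-layer-minDeg {C = C} C-cores {t} {S} {i} {y} S-deg i≤∣S∣ Cy-least =
      let K , K-core@(K-deg , K-max) = core-exists G t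
          x , Cx≡K = Equivalence.to (C-cores K) (t , K-core)
          i≤∣Cx∣ = subst (λ Z → i ≤ ∣ Z ∣) (sym Cx≡K) (≤-trans i≤∣S∣ (p⊆q⇒∣p∣≤∣q∣ (K-max S S-deg)))
          Cy⊆K = subst (C y ⊆_) Cx≡K (Cy-least x i≤∣Cx∣)
          _ , Cy-core = Equivalence.from (C-cores (C y)) (y , refl)
      in  core-⊆-MinDeg G Cy-core Cy⊆K K-deg


open import Defs
open import Data.Nat using (ℕ; suc; _≤_)
open import Data.Fin using (Fin)
open import Data.Fin.Subset using (Subset)
open import Data.Product using (∃)
open import Data.Rational using (½; _*_) renaming (_≤_ to _≤ℚ_)
open import Function.Bundles using (_⇔_)
open import Relation.Binary.PropositionalEquality using (_≡_)

open import Data.Product using (_,_; proj₁; proj₂)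
import Relation.Binary.PropositionalEquality as ≡
open Lemmas
  using ( profile-spec; locallyDense-layer-minDeg; core-layer-minDeg
        ; MinDeg⇒*∣─∣≤2*emCount; ½*frac≤frac; p⊂q⇒∣q─p∣>0 )

proposition9 : ∀ {n : ℕ} (G : Graph n) → 1 ≤ n →
    (k : ℕ) (B : Fin (suc k) → Subset n) → IsChain B →
    (∀ (W : Subset n) → LocallyDense G W ⇔ ∃ (λ j → B j ≡ W)) →
    (l : ℕ) (C : Fin (suc l) → Subset n) → IsChain C →
    (∀ (W : Subset n) → ∃ (λ t → IsCore G t W) ⇔ ∃ (λ j → C j ≡ W)) →
    ∀ (i : ℕ) → 1 ≤ i → i ≤ n →
    ½ * profile G k B i ≤ℚ profile G l C i
proposition9 G _ _ _ B-chain B-dense _ _ C-chain C-cores _ 1≤i i≤n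
  with profile-spec G B-chain 1≤i i≤n | profile-spec G C-chain 1≤i i≤n
... | j , pB≡ , i≤∣S∣ , _ | j′ , pC≡ , _ , C-least =
  let t , S≤t , S-deg = locallyDense-layer-minDeg G B-chain B-dense j
      Q-deg = core-layer-minDeg G C-cores S-deg i≤∣S∣ C-least
      A⊂S = proj₂ (proj₂ B-chain) j
      P⊂Q = proj₂ (proj₂ C-chain) j′
  in  ≡.subst₂ (λ p q → ½ * p ≤ℚ q) (≡.sym pB≡) (≡.sym pC≡)
        (½*frac≤frac (p⊂q⇒∣q─p∣>0 A⊂S) (p⊂q⇒∣q─p∣>0 P⊂Q) S≤t
          (MinDeg⇒*∣─∣≤2*emCount G Q-deg (proj₁ P⊂Q)))
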